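{- Let $0<\epsilon\le 1/3$ and let $R,d\ge1$ be integers. For each $i\in[R]$, the function $F:V_H^R\to\{0,1\}$ defined by $F(x)=1$ if $x_i\in\{s,t\}$ and $F(x)=0$ otherwise satisfies \[ \mathbb E_{X,Y\sim\mu_H^{\otimes R}}|F(X)-F(Y)|=\tfrac12\qquad\text{and}\qquad \mathbb E_{(X,Y_1,\dots,Y_d)\sim\mathcal P_{H^R}}\max_j|F(X)-F(Y_j)|\le 2\epsilon, \] where $X,Y$ in the first expectation are independent.
   Context: $H$ is the Markov chain on $V_H=\{s,t,t',s'\}$ with transition probabilities $p(s|s)=p(s'|s')=1-\frac{\epsilon}{1-2\epsilon}$, $p(t|s)=p(t'|s')=\frac{\epsilon}{1-2\epsilon}$, $p(s|t)=p(s'|t')=\frac12$, $p(t'|t)=p(t|t')=\frac12$ (all other transitions have probability $0$); its stationary distribution is $\mu_H(s)=\mu_H(s')=\frac12-\epsilon$, $\mu_H(t)=\mu_H(t')=\epsilon$. $H^R$ is the product chain on $V_H^R$ in which each coordinate moves independently according to $H$; its stationary distribution is $\mu_H^{\otimes R}$. The distribution $\mathcal P_{H^R}$ on $(V_H^R)^{d+1}$ is: sample $X\sim\mu_H^{\otimes R}$, then sample $Y_1,\dots,Y_d$ independently, each by one step of $H^R$ from $X$.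
   Formalization: The parameter ε takes only rational values with $0<\epsilon\le 1/3$, so the chain H, its stationary distribution μ_H and both expectations are taken over ℚ. -}

module Defs where

open import Data.Nat using (ℕ; zero; suc)
open import Data.Fin using (Fin)
open import Data.Bool using (Bool; true; false; if_then_else_)
open import Data.List using (List; []; _∷_; map; foldr; concatMap)
open import Data.Vec using (Vec; []; _∷_; lookup; toList; zipWith)
open import Data.Rational using (ℚ; 0ℚ; 1ℚ; ½; _+_; _*_; _-_; _÷_; _⊔_; ∣_∣; ≢-nonZero)
open import Data.Rational.Properties using (_≟_)
open import Relation.Nullary using (yes; no)

data VH : Set where
  s t t' s' : VH

allVH : List VH
allVH = s ∷ t ∷ t' ∷ s' ∷ []

-- total division on ℚ (only ever used with nonzero denominator 1 - 2ε, ε ≤ 1/3)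
divℚ : ℚ → ℚ → ℚ
divℚ p q with q ≟ 0ℚ
... | yes _ = 0ℚ
... | no q≢0 = _÷_ p q {{≢-nonZero q≢0}}

two : ℚ
two = 1ℚ + 1ℚ

μH : ℚ → VH → ℚ
μH ε s  = ½ - ε
μH ε s' = ½ - ε
μH ε t  = ε
μH ε t' = ε

-- transition probabilities: pH ε x y = p(y | x)
pH : ℚ → VH → VH → ℚ
pH ε s  s  = 1ℚ - divℚ ε (1ℚ - two * ε)
pH ε s  t  = divℚ ε (1ℚ - two * ε)
pH ε s' s' = 1ℚ - divℚ ε (1ℚ - two * ε)
pH ε s' t' = divℚ ε (1ℚ - two * ε)
pH ε t  s  = ½
pH ε t  t' = ½
pH ε t' s' = ½
pH ε t' t  = ½
pH ε _  _  = 0ℚ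

sumL : List ℚ → ℚ
sumL = foldr _+_ 0ℚ

prodL : List ℚ → ℚ
prodL = foldr _*_ 1ℚ

-- maximum of a list of nonnegative rationals (0 for the empty list)
maxL : List ℚ → ℚ
maxL = foldr _⊔_ 0ℚ

allVecs : {A : Set} → List A → (n : ℕ) → List (Vec A n)
allVecs xs zero = [] ∷ []
allVecs xs (suc n) = concatMap (λ x → map (x ∷_) (allVecs xs n)) xs

ΣV : (R : ℕ) → (Vec VH R → ℚ) → ℚ
ΣV R f = sumL (map f (allVecs allVH R))

μR : ℚ → (R : ℕ) → Vec VH R → ℚ
μR ε R x = prodL (toList (Data.Vec.map (μH ε) x))

pR : ℚ → (R : ℕ) → Vec VH R → Vec VH R → ℚ
pR ε R x y = prodL (toList (zipWith (pH ε) x y))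

inST : VH → Bool
inST s  = true
inST t  = true
inST t' = false
inST s' = false

F : {R : ℕ} → Fin R → Vec VH R → ℚ
F i x = if inST (lookup x i) then 1ℚ else 0ℚ

E-indep : ℚ → (R : ℕ) → Fin R → ℚ
E-indep ε R i = ΣV R (λ x → ΣV R (λ y → μR ε R x * μR ε R y * ∣ F i x - F i y ∣))

E-P : ℚ → (R d : ℕ) → Fin R → ℚ
E-P ε R d i =
  ΣV R (λ x → sumL (map (λ ys →
      μR ε R x
      * prodL (toList (Data.Vec.map (pR ε R x) ys))
      * maxL (toList (Data.Vec.map (λ y → ∣ F i x - F i y ∣) ys)))
    (allVecs (allVecs allVH R) d)))

module Submission where

-- Everything reduces to one coordinate. Summing out the other coordinates of the product
-- measures leaves, for the first claim, E |f(X_i) − f(Y_i)| with f the indicator of {s, t}: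
-- whatever X_i is, Y_i lands on the other side with probability μ_H{t', s'} = μ_H{s, t} = ½.
-- For the second claim, a step of H from s or s' never crosses between {s, t} and {t', s'},
-- so max_j |F(X) − F(Y_j)| vanishes almost surely unless X_i ∈ {t, t'}, and it is at most 1
-- otherwise; hence the expectation is at most μ_H{t, t'} = 2ε.

open import Defs
open import Data.Nat using (ℕ)
open import Data.Fin using (Fin)
open import Data.Product using (_×_)
open import Relation.Binary.PropositionalEquality using (_≡_)
open import Data.Rational using (ℚ; 0ℚ; ½; _*_; _<_; _≤_; _/_)
open import Data.Integer using (+_)

open import Data.Bool using (Bool; true; false; if_then_else_)
open import Data.Fin using (zero; suc)
open import Data.List using (List; []; _∷_; _++_; concatMap)
import Data.List as List
open import Data.Product using (_,_; proj₁; proj₂)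
open import Data.Rational using (1ℚ; _+_; _-_; -_; ∣_∣; _⊔_; 1/_; _≤?_; nonNegative; positive; ≢-nonZero)
open import Data.Rational.Properties
  using (_≟_; ≤-refl; ≤-trans; ≤-reflexive; <⇒≤; <-≤-trans; +-mono-≤; +-monoˡ-≤; +-identityˡ; +-assoc;
         +-inverseʳ; *-identityˡ; *-identityʳ; *-zeroˡ; *-zeroʳ; *-assoc; *-comm; *-distribˡ-+; *-inverseˡ;
         *-monoˡ-≤-nonNeg; *-cancelʳ-≤-pos; nonNegative⁻¹; nonNeg*nonNeg⇒nonNeg; ∣-∣-nonNeg;
         p≤q⇒p⊔q≡q; ⊔-lub; ⊔-mono-≤; module ≤-Reasoning)
open import Data.Rational.Solver using (module +-*-Solver)
open import Data.Sum using (_⊎_; inj₁; inj₂)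
open import Data.Vec using (Vec; []; _∷_; lookup; toList; zipWith)
import Data.Vec as Vec
open import Relation.Binary.PropositionalEquality
  using (refl; sym; trans; cong; cong₂; subst; subst₂; module ≡-Reasoning)
open import Relation.Nullary using (yes; no)
open import Relation.Nullary.Decidable using (True; toWitness)

open +-*-Solver using (solve; _:+_; _:*_; _:-_; con; _:=_)

sumOver : {A : Set} → List A → (A → ℚ) → ℚ
sumOver xs f = sumL (List.map f xs)

sumOver-cong : {A : Set} (xs : List A) {f g : A → ℚ} → (∀ a → f a ≡ g a) → sumOver xs f ≡ sumOver xs g
sumOver-cong []       f≡g = refl
sumOver-cong (a ∷ xs) f≡g = cong₂ _+_ (f≡g a) (sumOver-cong xs f≡g)

sumOver-mono-≤ : {A : Set} (xs : List A) {f g : A → ℚ} → (∀ a → f a ≤ g a) → sumOver xs f ≤ sumOver xs g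
sumOver-mono-≤ []       f≤g = ≤-refl
sumOver-mono-≤ (a ∷ xs) f≤g = +-mono-≤ (f≤g a) (sumOver-mono-≤ xs f≤g)

sumOver-*ˡ : {A : Set} (xs : List A) (c : ℚ) (f : A → ℚ) → sumOver xs (λ a → c * f a) ≡ c * sumOver xs f
sumOver-*ˡ []       c f = sym (*-zeroʳ c)
sumOver-*ˡ (a ∷ xs) c f =
  trans (cong (_+_ (c * f a)) (sumOver-*ˡ xs c f)) (sym (*-distribˡ-+ c (f a) (sumOver xs f)))

sumOver-++ : {A : Set} (xs ys : List A) (f : A → ℚ) → sumOver (xs ++ ys) f ≡ sumOver xs f + sumOver ys f
sumOver-++ []       ys f = sym (+-identityˡ _)
sumOver-++ (a ∷ xs) ys f =
  trans (cong (_+_ (f a)) (sumOver-++ xs ys f)) (sym (+-assoc (f a) (sumOver xs f) (sumOver ys f)))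

sumOver-concatMap : {A B : Set} (xs : List A) (g : A → List B) (f : B → ℚ) →
                    sumOver (concatMap g xs) f ≡ sumOver xs (λ a → sumOver (g a) f)
sumOver-concatMap []       g f = refl
sumOver-concatMap (a ∷ xs) g f =
  trans (sumOver-++ (g a) (concatMap g xs) f) (cong (_+_ (sumOver (g a) f)) (sumOver-concatMap xs g f))

sumOver-map : {A B : Set} (xs : List A) (h : A → B) (f : B → ℚ) →
              sumOver (List.map h xs) f ≡ sumOver xs (λ a → f (h a))
sumOver-map []       h f = refl
sumOver-map (a ∷ xs) h f = cong (_+_ (f (h a))) (sumOver-map xs h f)

sumOver-allVecs-suc : {A : Set} (xs : List A) (n : ℕ) (f : Vec A (ℕ.suc n) → ℚ) →
                      sumOver (allVecs xs (ℕ.suc n)) f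
                      ≡ sumOver xs (λ a → sumOver (allVecs xs n) (λ v → f (a ∷ v)))
sumOver-allVecs-suc xs n f =
  trans (sumOver-concatMap xs _ f) (sumOver-cong xs (λ a → sumOver-map (allVecs xs n) (a ∷_) f))

prodMap : {A : Set} → (A → ℚ) → {n : ℕ} → Vec A n → ℚ
prodMap f v = prodL (toList (Vec.map f v))

prodZip : {A : Set} → (A → A → ℚ) → {n : ℕ} → Vec A n → Vec A n → ℚ
prodZip k x y = prodL (toList (zipWith k x y))

sumOver-prodMap : {A : Set} (xs : List A) (f : A → ℚ) → sumOver xs f ≡ 1ℚ → (n : ℕ) →
                  sumOver (allVecs xs n) (prodMap f) ≡ 1ℚ
sumOver-prodMap xs f Σf≡1 ℕ.zero    = refl
sumOver-prodMap xs f Σf≡1 (ℕ.suc n) = begin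
  sumOver (allVecs xs (ℕ.suc n)) (prodMap f)                  ≡⟨ sumOver-allVecs-suc xs n (prodMap f) ⟩
  sumOver xs (λ a → sumOver (allVecs xs n) (λ v → f a * prodMap f v)) ≡⟨ sumOver-cong xs factor ⟩
  sumOver xs f                                                ≡⟨ Σf≡1 ⟩
  1ℚ                                                          ∎
  where
  open ≡-Reasoning
  factor : ∀ a → sumOver (allVecs xs n) (λ v → f a * prodMap f v) ≡ f a
  factor a = trans (sumOver-*ˡ (allVecs xs n) (f a) (prodMap f))
                   (trans (cong (f a *_) (sumOver-prodMap xs f Σf≡1 n)) (*-identityʳ (f a)))

sumOver-prodZip : {A : Set} (xs : List A) (k : A → A → ℚ) → (∀ a → sumOver xs (k a) ≡ 1ℚ) →
                  {n : ℕ} (x : Vec A n) → sumOver (allVecs xs n) (prodZip k x) ≡ 1ℚ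
sumOver-prodZip xs k Σk≡1 []              = refl
sumOver-prodZip xs k Σk≡1 {ℕ.suc n} (a ∷ x) = begin
  sumOver (allVecs xs (ℕ.suc n)) (prodZip k (a ∷ x))                   ≡⟨ sumOver-allVecs-suc xs n _ ⟩
  sumOver xs (λ b → sumOver (allVecs xs n) (λ v → k a b * prodZip k x v)) ≡⟨ sumOver-cong xs factor ⟩
  sumOver xs (k a)                                                     ≡⟨ Σk≡1 a ⟩
  1ℚ                                                                   ∎
  where
  open ≡-Reasoning
  factor : ∀ b → sumOver (allVecs xs n) (λ v → k a b * prodZip k x v) ≡ k a b
  factor b = trans (sumOver-*ˡ (allVecs xs n) (k a b) (prodZip k x))
                   (trans (cong (k a b *_) (sumOver-prodZip xs k Σk≡1 x)) (*-identityʳ (k a b)))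

*-swapʳ : ∀ p q r → p * q * r ≡ p * r * q
*-swapʳ = solve 3 (λ p q r → p :* q :* r := p :* r :* q) refl

sumOver-prodMap-marginal : {A : Set} (xs : List A) (f : A → ℚ) → sumOver xs f ≡ 1ℚ →
                           {n : ℕ} (i : Fin n) (g : A → ℚ) →
                           sumOver (allVecs xs n) (λ v → prodMap f v * g (lookup v i))
                           ≡ sumOver xs (λ a → f a * g a)
sumOver-prodMap-marginal xs f Σf≡1 {ℕ.suc n} zero g =
  trans (sumOver-allVecs-suc xs n _) (sumOver-cong xs factor)
  where
  factor : ∀ a → sumOver (allVecs xs n) (λ v → f a * prodMap f v * g a) ≡ f a * g a
  factor a = begin
    sumOver (allVecs xs n) (λ v → f a * prodMap f v * g a)
      ≡⟨ sumOver-cong (allVecs xs n) (λ v → *-swapʳ (f a) (prodMap f v) (g a)) ⟩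
    sumOver (allVecs xs n) (λ v → f a * g a * prodMap f v) ≡⟨ sumOver-*ˡ (allVecs xs n) (f a * g a) (prodMap f) ⟩
    f a * g a * sumOver (allVecs xs n) (prodMap f)         ≡⟨ cong (f a * g a *_) (sumOver-prodMap xs f Σf≡1 n) ⟩
    f a * g a * 1ℚ                                         ≡⟨ *-identityʳ (f a * g a) ⟩
    f a * g a                                              ∎
    where open ≡-Reasoning
sumOver-prodMap-marginal xs f Σf≡1 {ℕ.suc n} (suc j) g = begin
  sumOver (allVecs xs (ℕ.suc n)) (λ v → prodMap f v * g (lookup v (suc j)))
    ≡⟨ sumOver-allVecs-suc xs n _ ⟩
  sumOver xs (λ a → sumOver (allVecs xs n) (λ v → f a * prodMap f v * g (lookup v j)))
    ≡⟨ sumOver-cong xs factor ⟩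
  sumOver xs (λ a → E * f a) ≡⟨ sumOver-*ˡ xs E f ⟩
  E * sumOver xs f           ≡⟨ cong (E *_) Σf≡1 ⟩
  E * 1ℚ                     ≡⟨ *-identityʳ E ⟩
  E                          ∎
  where
  open ≡-Reasoning
  E : ℚ
  E = sumOver xs (λ a → f a * g a)
  factor : ∀ a → sumOver (allVecs xs n) (λ v → f a * prodMap f v * g (lookup v j)) ≡ E * f a
  factor a =
    trans (sumOver-cong (allVecs xs n) (λ v → *-assoc (f a) (prodMap f v) (g (lookup v j))))
      (trans (sumOver-*ˡ (allVecs xs n) (f a) _)
        (trans (cong (f a *_) (sumOver-prodMap-marginal xs f Σf≡1 j g)) (*-comm (f a) E)))

prodZip-zero : {A : Set} (k : A → A → ℚ) {n : ℕ} (x y : Vec A n) (i : Fin n) →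
               k (lookup x i) (lookup y i) ≡ 0ℚ → prodZip k x y ≡ 0ℚ
prodZip-zero k (a ∷ x) (b ∷ y) zero    k≡0 = trans (cong (_* prodZip k x y) k≡0) (*-zeroˡ (prodZip k x y))
prodZip-zero k (a ∷ x) (b ∷ y) (suc j) k≡0 = trans (cong (k a b *_) (prodZip-zero k x y j k≡0)) (*-zeroʳ (k a b))

≤-decide : ∀ {p q} {p≤q : True (p ≤? q)} → p ≤ q
≤-decide {p≤q = p≤q} = toWitness p≤q

*-nonNeg : ∀ {p q} → 0ℚ ≤ p → 0ℚ ≤ q → 0ℚ ≤ p * q
*-nonNeg {p} {q} 0≤p 0≤q =
  nonNegative⁻¹ (p * q) {{nonNeg*nonNeg⇒nonNeg p {{nonNegative 0≤p}} q {{nonNegative 0≤q}}}}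

≤⇒0≤- : ∀ {p q} → p ≤ q → 0ℚ ≤ q - p
≤⇒0≤- {p} {q} p≤q = subst (_≤ q - p) (+-inverseʳ p) (+-monoˡ-≤ (- p) p≤q)

0≤-⇒≤ : ∀ {p q} → 0ℚ ≤ q - p → p ≤ q
0≤-⇒≤ {p} {q} 0≤q-p = subst₂ _≤_ (+-identityˡ p) (-+-cancel p q) (+-monoˡ-≤ p 0≤q-p)
  where
  -+-cancel : ∀ p q → q - p + p ≡ q
  -+-cancel = solve 2 (λ p q → q :- p :+ p := q) refl

-- divℚ p 0 is the junk value 0, which happens to satisfy the bounds as well.
divℚ-∈[0,1] : ∀ p q → 0ℚ ≤ p → p ≤ q → 0ℚ < q → (0ℚ ≤ divℚ p q) × (divℚ p q ≤ 1ℚ)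
divℚ-∈[0,1] p q 0≤p p≤q 0<q with q ≟ 0ℚ
... | yes _   = ≤-refl , ≤-decide
... | no  q≢0 = *-cancelʳ-≤-pos q (subst₂ _≤_ (sym (*-zeroˡ q)) (sym cancel) 0≤p)
              , *-cancelʳ-≤-pos q (subst₂ _≤_ (sym cancel) (sym (*-identityˡ q)) p≤q)
  where
  instance
    q-positive = positive 0<q
    q-nonZero  = ≢-nonZero q≢0
  cancel : p * (1/ q) * q ≡ p
  cancel = trans (*-assoc p _ q) (trans (cong (p *_) (*-inverseˡ q)) (*-identityʳ p))

maxMap : {B : Set} → (B → ℚ) → {n : ℕ} → Vec B n → ℚ
maxMap φ ys = maxL (toList (Vec.map φ ys))

maxMap-nonNeg : {B : Set} (φ : B → ℚ) → (∀ y → 0ℚ ≤ φ y) →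
                {n : ℕ} (ys : Vec B n) → 0ℚ ≤ maxMap φ ys
maxMap-nonNeg φ 0≤φ []       = ≤-refl
maxMap-nonNeg φ 0≤φ (y ∷ ys) = ⊔-mono-≤ (0≤φ y) (maxMap-nonNeg φ 0≤φ ys)

maxMap-≤ : {B : Set} (φ : B → ℚ) {c : ℚ} → 0ℚ ≤ c → (∀ y → φ y ≤ c) →
           {n : ℕ} (ys : Vec B n) → maxMap φ ys ≤ c
maxMap-≤ φ 0≤c φ≤c []       = 0≤c
maxMap-≤ φ 0≤c φ≤c (y ∷ ys) = ⊔-lub (φ≤c y) (maxMap-≤ φ 0≤c φ≤c ys)

prodMap-nonNeg : {B : Set} (f : B → ℚ) → (∀ b → 0ℚ ≤ f b) → {n : ℕ} (v : Vec B n) → 0ℚ ≤ prodMap f v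
prodMap-nonNeg f 0≤f []      = ≤-decide
prodMap-nonNeg f 0≤f (b ∷ v) = *-nonNeg (0≤f b) (prodMap-nonNeg f 0≤f v)

prodZip-nonNeg : {A : Set} (k : A → A → ℚ) → (∀ a b → 0ℚ ≤ k a b) →
                 {n : ℕ} (x y : Vec A n) → 0ℚ ≤ prodZip k x y
prodZip-nonNeg k 0≤k []      []      = ≤-decide
prodZip-nonNeg k 0≤k (a ∷ x) (b ∷ y) = *-nonNeg (0≤k a b) (prodZip-nonNeg k 0≤k x y)

prodMap*maxMap≡0 : {B : Set} (w φ : B → ℚ) → (∀ y → 0ℚ ≤ φ y) → (∀ y → w y ≡ 0ℚ ⊎ φ y ≡ 0ℚ) →
                   {n : ℕ} (ys : Vec B n) → prodMap w ys * maxMap φ ys ≡ 0ℚ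
prodMap*maxMap≡0 w φ 0≤φ w0⊎φ0 []       = refl
prodMap*maxMap≡0 w φ 0≤φ w0⊎φ0 (y ∷ ys) with w0⊎φ0 y
... | inj₁ wy≡0 = begin
  w y * W * (φ y ⊔ M) ≡⟨ cong (λ z → z * W * (φ y ⊔ M)) wy≡0 ⟩
  0ℚ * W * (φ y ⊔ M)  ≡⟨ cong (_* (φ y ⊔ M)) (*-zeroˡ W) ⟩
  0ℚ * (φ y ⊔ M)      ≡⟨ *-zeroˡ (φ y ⊔ M) ⟩
  0ℚ                  ∎
  where
  open ≡-Reasoning
  W = prodMap w ys
  M = maxMap φ ys
... | inj₂ φy≡0 = begin
  w y * W * (φ y ⊔ M) ≡⟨ cong (λ z → w y * W * (z ⊔ M)) φy≡0 ⟩
  w y * W * (0ℚ ⊔ M)  ≡⟨ cong (w y * W *_) (p≤q⇒p⊔q≡q (maxMap-nonNeg φ 0≤φ ys)) ⟩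
  w y * W * M         ≡⟨ *-assoc (w y) W M ⟩
  w y * (W * M)       ≡⟨ cong (w y *_) (prodMap*maxMap≡0 w φ 0≤φ w0⊎φ0 ys) ⟩
  w y * 0ℚ            ≡⟨ *-zeroʳ (w y) ⟩
  0ℚ                  ∎
  where
  open ≡-Reasoning
  W = prodMap w ys
  M = maxMap φ ys

𝟙 : Bool → ℚ
𝟙 b = if b then 1ℚ else 0ℚ

∣𝟙-𝟙∣-nonNeg : ∀ b c → 0ℚ ≤ ∣ 𝟙 b - 𝟙 c ∣
∣𝟙-𝟙∣-nonNeg b c = nonNegative⁻¹ _ {{∣-∣-nonNeg (𝟙 b - 𝟙 c)}}

∣𝟙-𝟙∣≤1 : ∀ b c → ∣ 𝟙 b - 𝟙 c ∣ ≤ 1ℚ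
∣𝟙-𝟙∣≤1 true  true  = ≤-decide
∣𝟙-𝟙∣≤1 true  false = ≤-decide
∣𝟙-𝟙∣≤1 false true  = ≤-decide
∣𝟙-𝟙∣≤1 false false = ≤-decide

∣𝟙-𝟙∣-refl : ∀ b → ∣ 𝟙 b - 𝟙 b ∣ ≡ 0ℚ
∣𝟙-𝟙∣-refl b = cong ∣_∣ (+-inverseʳ (𝟙 b))

module ChainH (ε : ℚ) (0<ε : 0ℚ < ε) (ε≤⅓ : ε ≤ (+ 1) / 3) where

  0≤ε : 0ℚ ≤ ε
  0≤ε = <⇒≤ 0<ε

  0≤½-ε : 0ℚ ≤ ½ - ε
  0≤½-ε = ≤⇒0≤- (≤-trans ε≤⅓ (≤-decide {(+ 1) / 3} {½}))

  ε≤1-2ε : ε ≤ 1ℚ - two * ε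
  ε≤1-2ε = 0≤-⇒≤ (subst (0ℚ ≤_) (triple ε ((+ 1) / 3))
                        (*-nonNeg (≤-decide {0ℚ} {1ℚ + 1ℚ + 1ℚ}) (≤⇒0≤- ε≤⅓)))
    where
    triple : ∀ e h → (1ℚ + 1ℚ + 1ℚ) * (h - e) ≡ (1ℚ + 1ℚ + 1ℚ) * h - (1ℚ + 1ℚ) * e - e
    triple = solve 2 (λ e h → (con 1ℚ :+ con 1ℚ :+ con 1ℚ) :* (h :- e)
                           := (con 1ℚ :+ con 1ℚ :+ con 1ℚ) :* h :- (con 1ℚ :+ con 1ℚ) :* e :- e) refl

  leave-s : (0ℚ ≤ divℚ ε (1ℚ - two * ε)) × (divℚ ε (1ℚ - two * ε) ≤ 1ℚ)
  leave-s = divℚ-∈[0,1] ε (1ℚ - two * ε) 0≤ε ε≤1-2ε (<-≤-trans 0<ε ε≤1-2ε)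

  μH-nonNeg : ∀ a → 0ℚ ≤ μH ε a
  μH-nonNeg s  = 0≤½-ε
  μH-nonNeg t  = 0≤ε
  μH-nonNeg t' = 0≤ε
  μH-nonNeg s' = 0≤½-ε

  pH-nonNeg : ∀ a b → 0ℚ ≤ pH ε a b
  pH-nonNeg s  s  = ≤⇒0≤- (proj₂ leave-s)
  pH-nonNeg s  t  = proj₁ leave-s
  pH-nonNeg s' t' = proj₁ leave-s
  pH-nonNeg s' s' = ≤⇒0≤- (proj₂ leave-s)
  pH-nonNeg t  s  = ≤-decide
  pH-nonNeg t  t' = ≤-decide
  pH-nonNeg t' s' = ≤-decide
  pH-nonNeg t' t  = ≤-decide
  pH-nonNeg s  t' = ≤-refl
  pH-nonNeg s  s' = ≤-refl
  pH-nonNeg t  t  = ≤-refl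
  pH-nonNeg t  s' = ≤-refl
  pH-nonNeg t' s  = ≤-refl
  pH-nonNeg t' t' = ≤-refl
  pH-nonNeg s' s  = ≤-refl
  pH-nonNeg s' t  = ≤-refl

  -- Sums over allVH unfold to closed ring expressions in ε and ½, and ½ + ½ reduces to 1ℚ.
  μH-sum : sumOver allVH (μH ε) ≡ 1ℚ
  μH-sum = solve 2 (λ e h → (h :- e) :+ (e :+ (e :+ ((h :- e) :+ con 0ℚ))) := h :+ h) refl ε ½

  pH-rowSum : ∀ a → sumOver allVH (pH ε a) ≡ 1ℚ
  pH-rowSum s  = leave+stay (divℚ ε (1ℚ - two * ε))
    where
    leave+stay : ∀ q → 1ℚ - q + (q + (0ℚ + (0ℚ + 0ℚ))) ≡ 1ℚ
    leave+stay = solve 1 (λ q → con 1ℚ :- q :+ (q :+ (con 0ℚ :+ (con 0ℚ :+ con 0ℚ))) := con 1ℚ) refl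
  pH-rowSum t  = refl
  pH-rowSum t' = refl
  pH-rowSum s' = leave+stay (divℚ ε (1ℚ - two * ε))
    where
    leave+stay : ∀ q → 0ℚ + (0ℚ + (q + (1ℚ - q + 0ℚ))) ≡ 1ℚ
    leave+stay = solve 1 (λ q → con 0ℚ :+ (con 0ℚ :+ (q :+ (con 1ℚ :- q :+ con 0ℚ))) := con 1ℚ) refl

  crossing : VH → ℚ
  crossing a = sumOver allVH (λ b → μH ε b * ∣ 𝟙 (inST a) - 𝟙 (inST b) ∣)

  crossing≡½ : ∀ a → crossing a ≡ ½
  crossing≡½ s  = mass-of-t'-s' ε ½
    where
    mass-of-t'-s' : ∀ e h → (h - e) * 0ℚ + (e * 0ℚ + (e * 1ℚ + ((h - e) * 1ℚ + 0ℚ))) ≡ h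
    mass-of-t'-s' = solve 2 (λ e h → (h :- e) :* con 0ℚ :+ (e :* con 0ℚ
                                      :+ (e :* con 1ℚ :+ ((h :- e) :* con 1ℚ :+ con 0ℚ))) := h) refl
  crossing≡½ t  = crossing≡½ s
  crossing≡½ t' = mass-of-s-t ε ½
    where
    mass-of-s-t : ∀ e h → (h - e) * 1ℚ + (e * 1ℚ + (e * 0ℚ + ((h - e) * 0ℚ + 0ℚ))) ≡ h
    mass-of-s-t = solve 2 (λ e h → (h :- e) :* con 1ℚ :+ (e :* con 1ℚ
                                    :+ (e :* con 0ℚ :+ ((h :- e) :* con 0ℚ :+ con 0ℚ))) := h) refl
  crossing≡½ s' = crossing≡½ t'

  -- The states from which one step of H may change the value of inST.
  boundary : VH → ℚ
  boundary s  = 0ℚ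
  boundary t  = 1ℚ
  boundary t' = 1ℚ
  boundary s' = 0ℚ

  μH-boundary : sumOver allVH (λ a → μH ε a * boundary a) ≡ two * ε
  μH-boundary = solve 2 (λ e h → (h :- e) :* con 0ℚ :+ (e :* con 1ℚ
                                  :+ (e :* con 1ℚ :+ ((h :- e) :* con 0ℚ :+ con 0ℚ)))
                              := (con 1ℚ :+ con 1ℚ) :* e) refl ε ½

  boundary⊎step-keeps-inST : ∀ a → boundary a ≡ 1ℚ
                                   ⊎ (boundary a ≡ 0ℚ × (∀ b → pH ε a b ≡ 0ℚ ⊎ inST a ≡ inST b))
  boundary⊎step-keeps-inST s  =
    inj₂ (refl , λ { s → inj₂ refl ; t → inj₂ refl ; t' → inj₁ refl ; s' → inj₁ refl })
  boundary⊎step-keeps-inST t  = inj₁ refl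
  boundary⊎step-keeps-inST t' = inj₁ refl
  boundary⊎step-keeps-inST s' =
    inj₂ (refl , λ { s → inj₁ refl ; t → inj₁ refl ; t' → inj₂ refl ; s' → inj₂ refl })

  E-indep≡½ : (R : ℕ) (i : Fin R) → E-indep ε R i ≡ ½
  E-indep≡½ R i = begin
    E-indep ε R i                                       ≡⟨ sumOver-cong Xs crossing-from ⟩
    sumOver Xs (λ x → μR ε R x * crossing (lookup x i)) ≡⟨ sumOver-prodMap-marginal allVH (μH ε) μH-sum i crossing ⟩
    sumOver allVH (λ a → μH ε a * crossing a)           ≡⟨ sumOver-cong allVH crossing≡½-weighted ⟩
    sumOver allVH (λ a → ½ * μH ε a)                    ≡⟨ sumOver-*ˡ allVH ½ (μH ε) ⟩
    ½ * sumOver allVH (μH ε)                            ≡⟨ cong (½ *_) μH-sum ⟩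
    ½ * 1ℚ                                              ≡⟨ *-identityʳ ½ ⟩
    ½                                                   ∎
    where
    open ≡-Reasoning
    Xs : List (Vec VH R)
    Xs = allVecs allVH R
    crossing-from : ∀ x → sumOver Xs (λ y → μR ε R x * μR ε R y * ∣ F i x - F i y ∣)
                          ≡ μR ε R x * crossing (lookup x i)
    crossing-from x =
      trans (sumOver-cong Xs (λ y → *-assoc (μR ε R x) (μR ε R y) ∣ F i x - F i y ∣))
        (trans (sumOver-*ˡ Xs (μR ε R x) _)
          (cong (μR ε R x *_)
            (sumOver-prodMap-marginal allVH (μH ε) μH-sum i (λ b → ∣ F i x - 𝟙 (inST b) ∣))))
    crossing≡½-weighted : ∀ a → μH ε a * crossing a ≡ ½ * μH ε a
    crossing≡½-weighted a = trans (cong (μH ε a *_) (crossing≡½ a)) (*-comm (μH ε a) ½)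

  module _ (R : ℕ) (i : Fin R) where

    distF : Vec VH R → Vec VH R → ℚ
    distF x y = ∣ F i x - F i y ∣

    stepWeight : Vec VH R → {d : ℕ} → Vec (Vec VH R) d → ℚ
    stepWeight x ys = prodMap (pR ε R x) ys

    maxDistF : Vec VH R → {d : ℕ} → Vec (Vec VH R) d → ℚ
    maxDistF x ys = maxMap (distF x) ys

    stepWeight-nonNeg : ∀ x {d} (ys : Vec (Vec VH R) d) → 0ℚ ≤ stepWeight x ys
    stepWeight-nonNeg x = prodMap-nonNeg (pR ε R x) (prodZip-nonNeg (pH ε) pH-nonNeg x)

    maxDistF≤1 : ∀ x {d} (ys : Vec (Vec VH R) d) → maxDistF x ys ≤ 1ℚ
    maxDistF≤1 x = maxMap-≤ (distF x) ≤-decide (λ y → ∣𝟙-𝟙∣≤1 (inST (lookup x i)) (inST (lookup y i)))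

    step-keeps-F : ∀ x → (∀ b → pH ε (lookup x i) b ≡ 0ℚ ⊎ inST (lookup x i) ≡ inST b) →
                   ∀ y → pR ε R x y ≡ 0ℚ ⊎ distF x y ≡ 0ℚ
    step-keeps-F x keeps y with keeps (lookup y i)
    ... | inj₁ p≡0  = inj₁ (prodZip-zero (pH ε) x y i p≡0)
    ... | inj₂ same = inj₂ (trans (cong (λ b → ∣ F i x - 𝟙 b ∣) (sym same)) (∣𝟙-𝟙∣-refl (inST (lookup x i))))

    weightedMax≤boundary : ∀ x {d} (ys : Vec (Vec VH R) d) →
                           stepWeight x ys * maxDistF x ys ≤ stepWeight x ys * boundary (lookup x i)
    weightedMax≤boundary x ys with boundary⊎step-keeps-inST (lookup x i)
    ... | inj₁ b≡1 =
      subst (λ b → stepWeight x ys * maxDistF x ys ≤ stepWeight x ys * b) (sym b≡1)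
        (*-monoˡ-≤-nonNeg (stepWeight x ys) {{nonNegative (stepWeight-nonNeg x ys)}} (maxDistF≤1 x ys))
    ... | inj₂ (b≡0 , keeps) = ≤-reflexive (begin
      stepWeight x ys * maxDistF x ys
        ≡⟨ prodMap*maxMap≡0 (pR ε R x) (distF x) distF-nonNeg (step-keeps-F x keeps) ys ⟩
      0ℚ                                    ≡⟨ sym (*-zeroʳ (stepWeight x ys)) ⟩
      stepWeight x ys * 0ℚ                  ≡⟨ cong (stepWeight x ys *_) (sym b≡0) ⟩
      stepWeight x ys * boundary (lookup x i) ∎)
      where
      open ≡-Reasoning
      distF-nonNeg : ∀ y → 0ℚ ≤ distF x y
      distF-nonNeg y = ∣𝟙-𝟙∣-nonNeg (inST (lookup x i)) (inST (lookup y i))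

    E-P≤2ε : (d : ℕ) → E-P ε R d i ≤ two * ε
    E-P≤2ε d = begin
      E-P ε R d i
        ≤⟨ sumOver-mono-≤ Xs (λ x → sumOver-mono-≤ Yss (pointwise x)) ⟩
      sumOver Xs (λ x → sumOver Yss (λ ys → μR ε R x * boundary (lookup x i) * stepWeight x ys))
        ≡⟨ sumOver-cong Xs kernel-mass ⟩
      sumOver Xs (λ x → μR ε R x * boundary (lookup x i))
        ≡⟨ sumOver-prodMap-marginal allVH (μH ε) μH-sum i boundary ⟩
      sumOver allVH (λ a → μH ε a * boundary a)
        ≡⟨ μH-boundary ⟩
      two * ε ∎
      where
      open ≤-Reasoning
      Xs : List (Vec VH R)
      Xs = allVecs allVH R
      Yss : List (Vec (Vec VH R) d)
      Yss = allVecs Xs d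
      pointwise : ∀ x ys → μR ε R x * stepWeight x ys * maxDistF x ys
                           ≤ μR ε R x * boundary (lookup x i) * stepWeight x ys
      pointwise x ys = begin
        μ * P * M   ≡⟨ *-assoc μ P M ⟩
        μ * (P * M) ≤⟨ *-monoˡ-≤-nonNeg μ {{nonNegative (prodMap-nonNeg (μH ε) μH-nonNeg x)}}
                                          (weightedMax≤boundary x ys) ⟩
        μ * (P * b) ≡⟨ sym (*-assoc μ P b) ⟩
        μ * P * b   ≡⟨ *-swapʳ μ P b ⟩
        μ * b * P   ∎
        where
        μ P M b : ℚ
        μ = μR ε R x
        P = stepWeight x ys
        M = maxDistF x ys
        b = boundary (lookup x i)
      kernel-mass : ∀ x → sumOver Yss (λ ys → μR ε R x * boundary (lookup x i) * stepWeight x ys)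
                          ≡ μR ε R x * boundary (lookup x i)
      kernel-mass x =
        trans (sumOver-*ˡ Yss c (stepWeight x))
          (trans (cong (c *_) (sumOver-prodMap Xs (pR ε R x) (sumOver-prodZip allVH (pH ε) pH-rowSum x) d))
            (*-identityʳ c))
        where
        c : ℚ
        c = μR ε R x * boundary (lookup x i)

proposition5p1 : (ε : ℚ) → 0ℚ < ε → ε ≤ (+ 1) / 3 → (R d : ℕ) → 1 Data.Nat.≤ R → 1 Data.Nat.≤ d
    → (i : Fin R) → (E-indep ε R i ≡ ½) × (E-P ε R d i ≤ two * ε)
proposition5p1 ε 0<ε ε≤⅓ R d _ _ i = E-indep≡½ R i , E-P≤2ε R i d
  where open ChainH ε 0<ε ε≤⅓
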